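{- $\mathrm{MFA}^\cup$ does not cover $\mathrm{RCA}_1$: there exists a Horn-$\mathcal{SRIQ}$ TBox $\mathcal{T}$ that is $\mathrm{RCA}_1$ but not $\mathrm{MFA}^\cup$.
   Context: Terms are built from constants (individuals) and function symbols. A term $t'$ is a subterm of $t$ if $t'=t$, or $t=f(s_1,\dots,s_k)$ and $t'$ is a subterm of some $s_i$; it is a proper subterm if moreover $t'\ne t$. A term $t$ is $n$-cyclic iff there are terms $f(\vec s_1),\dots,f(\vec s_{n+1})$ (same function symbol $f$) such that $f(\vec s_{n+1})$ is a subterm of $t$ and $f(\vec s_i)$ is a proper subterm of $f(\vec s_{i+1})$ for $i=1,\dots,n$; $1$-cyclic terms are called cyclic. A fact is a ground atom. A Horn-$\mathcal{SRIQ}$ TBox is a finite set of axioms of the forms $A_1\sqcap\dots\sqcap A_n\sqsubseteq B$, $A\sqsubseteq\forall R.B$, $A\sqsubseteq\,\leq 1 R.B$, $A\sqsubseteq\exists R.B$ (existential axioms), $S\sqsubseteq R$, $S^-\sqsubseteq R$, $S\circ V\sqsubseteq R$, where $A_i,A,B$ are concept names ($\top,\bot$ among them) and $R,S,V$ role names, satisfying the usual Horn-$\mathcal{SRIQ}$ global restrictions. Each axiom is translated into a rule: $A_1\sqcap\dots\sqcap A_n\sqsubseteq B\mapsto A_1(x)\wedge\dots\wedge A_n(x)\to B(x)$; $A\sqsubseteq\forall R.B\mapsto A(x)\wedge R(x,y)\to B(y)$; $A\sqsubseteq\,\leq1R.B\mapsto A(x)\wedge R(x,y)\wedge B(y)\wedge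 R(x,z)\wedge B(z)\to y\approx z$; $A\sqsubseteq\exists R.B\mapsto A(x)\to\exists y[R(x,y)\wedge B(y)]$; $S\sqsubseteq R\mapsto S(x,y)\to R(x,y)$; $S^-\sqsubseteq R\mapsto S(y,x)\to R(x,y)$; $S\circ V\sqsubseteq R\mapsto S(x,y)\wedge V(y,z)\to R(x,z)$. $\mathcal{R}_\mathcal{T}$ is the set of translations of the axioms of $\mathcal{T}$ together with, for every predicate $p$ of arity $k$ occurring, the rule $p(x_1,\dots,x_k)\to\top(x_1)\wedge\dots\wedge\top(x_k)$. Rules of the form $\beta(\vec x,\vec z)\to\exists\vec y\,\eta(\vec x,\vec y)$ are TGDs, rules $\beta(\vec x)\to x\approx y$ are EGDs. For a rule set $\mathcal{R}$: $\mathcal{R}^\exists$ = TGDs with existentially quantified variables, $\mathcal{R}^\forall$ = TGDs without, $\mathcal{R}^\approx$ = EGDs. A program is a pair $\langle\mathcal{R},\mathcal{I}\rangle$ with $\mathcal{I}$ a finite set of equality-free facts. Skolemization: for a TGD $\rho=\beta(\vec x,\vec z)\to\exists\vec y\,\eta(\vec x,\vec y)$, $sk(\rho)$ is $\beta\to\eta\sigma_{sk}$ where $\sigma_{sk}$ maps each $y\in\vec y$ to $f^y_\rho(\vec x)$ with $f^y_\rho$ a fresh function symbol unique to $y$ and $\rho$. Restricted application: for a TGD $\rho$ and a set of facts $F$, $\rho_R(F)$ is the set of facts $\varphi$ such that there is a substitution $\sigma$ with $\beta\sigma\subseteq F$, $\varphi\in sk(\eta)\sigma$, and there is no substitution $\tau\supseteq\sigma$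 with $\eta\tau\subseteq F$; for a set of TGDs, $\mathcal{R}_R(F)=F\cup\bigcup_{\rho\in\mathcal{R}}\rho_R(F)$. The depth of a term is $0$ for constants and $1+\max_i dep(t_i)$ for $f(t_1,\dots,t_k)$. Fix a total strict order $\prec$ on terms with $t\prec u$ only if $dep(t)\le dep(u)$ ("$t$ is greater than $u$"). For a set of EGDs $\mathcal{R}$ and facts $F$, let $\mapsto$ be the minimal congruence relation on terms containing $(\sigma(x),\sigma(y))$ for every EGD $\beta(\vec x)\to x\approx y\in\mathcal{R}$ and substitution $\sigma$ with $\beta\sigma\subseteq F$; $\mathcal{R}(F)$ is obtained from $F$ by replacing every term $t$ by the $\prec$-greatest $u$ with $t\mapsto u$. The restricted chase sequence of $\langle\mathcal{R},\mathcal{I}\rangle$: $F_1=\mathcal{I}$, and for $i\ge2$, $F_i=\mathcal{R}^\approx(F_{i-1})$ if this differs from $F_{i-1}$; otherwise $F_i=(\mathcal{R}^\forall)_R(F_{i-1})$ if this differs from $F_{i-1}$; otherwise $F_i=(\mathcal{R}^\exists)_R(F_{i-1})$. The restricted chase is $\mathrm{rChase}=\bigcup_i F_i$. Restricted terms: for a term $t$: if $t=f^y_\rho(s)$ where $\rho=A(x)\to\exists y[R(x,y)\wedge B(y)]\in\mathcal{R}_\mathcal{T}$, let $\mathcal{I}(t)=\{A(s),R(s,t),B(t)\}\cup\mathcal{I}(s)$; otherwise $\mathcal{I}(t)=\emptyset$. Let $RT(\mathcal{T},t)=\langle\mathcal{R}_\mathcal{T}^\forall\cup\mathcal{R}_\mathcal{T}^\approx,\mathcal{I}(t)\rangle$.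 A term $t=f^y_\rho(s)$ with $\rho=A(x)\to\exists y[R(x,y)\wedge B(y)]$ is restricted with respect to $\mathcal{T}$ iff there is a term $u$ with $\{R([s],u),B(u)\}\subseteq\mathrm{rChase}(RT(\mathcal{T},s))$, where $[s]=v$ if $s$ is replaced by $v$ during the computation of the restricted chase sequence, and $[s]=s$ otherwise. The set $\mathcal{V}_\mathcal{T}$: let $\star$ be a special constant, $Eq$ a fresh binary predicate, and let the critical instance $\mathcal{I}^\star$ be the set of all facts $p(\star,\dots,\star)$ for predicates $p$ occurring in TGDs of $\mathcal{R}_\mathcal{T}$. $\mathcal{V}_\mathcal{T}$ is the set obtained from $\mathcal{I}^\star$ by repeatedly applying the following expansion rules (in any order) until none applies: ($\forall$-rule) for a TGD $\rho\in\mathcal{R}_\mathcal{T}^\forall$, add $\rho_R(\mathcal{V}_\mathcal{T})$; ($\exists$-rule) for $\rho=A(x)\to\exists y[R(x,y)\wedge B(y)]\in\mathcal{R}_\mathcal{T}$ and a term $t$ with $A(t)\in\mathcal{V}_\mathcal{T}$ such that $f^y_\rho(t)$ is not restricted with respect to $\mathcal{T}$, add $R(t,f^y_\rho(t))$ and $B(f^y_\rho(t))$; ($\approx$-rule) for an EGD $\beta\to x\approx y\in\mathcal{R}_\mathcal{T}$ and substitution $\sigma$ with $\beta\sigma\subseteq\mathcal{V}_\mathcal{T}$, add $Eq(\sigma(x),\sigma(y))$ and $Eq(\sigma(y),\sigma(x))$; ($Eq$-rule) if $Eq(t,u)\in\mathcal{V}_\mathcal{T}$ and $p(u_1,\dots,u_k)\in\mathcal{V}_\mathcal{T}$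 with $p\ne Eq$, $dep(t)\le dep(u)$ and $u=u_j$ for some $j$, add the fact obtained from $p(u_1,\dots,u_k)$ by replacing $u$ with $t$. A TBox $\mathcal{T}$ is $\mathrm{RCA}_n$ iff no $n$-cyclic term occurs in $\mathcal{V}_\mathcal{T}$. $\mathrm{MFA}^\cup$: Let $\Sigma_\mathcal{T}$ be the set of TGDs obtained from $\mathcal{R}_\mathcal{T}$ by replacing every EGD $\beta\to x\approx y$ by the TGD $\beta\to Eq(x,y)$. Let $\mathsf{Eq}=\{\top(x)\to Eq(x,x),\ Eq(x,y)\to Eq(y,x),\ Eq(x,z)\wedge Eq(z,y)\to Eq(x,y)\}$. A singularization of a rule $\rho$ is obtained by doing, for every variable $v$ in the body: rename its occurrences in the body by distinct fresh variables $v_1,\dots,v_m$, pick some $j\in\{1,\dots,m\}$, add $Eq(v_1,v_j),\dots,Eq(v_m,v_j)$ to the body, and replace every occurrence of $v$ in the head by $v_j$. $\mathrm{Sing}(\Sigma)$ is the set of all sets $\Sigma'$ consisting of $\mathsf{Eq}$ plus exactly one singularization of each rule of $\Sigma$. A set of TGDs $\Sigma$ is MFA iff the least set of facts containing the critical instance of $\Sigma$ (all facts $p(\star,\dots,\star)$ for predicates $p$ in $\Sigma$) and closed under the skolemized rules $sk(\rho)$, $\rho\in\Sigma$ (the oblivious chase) contains no cyclic term. $\mathcal{T}$ is $\mathrm{MFA}^\cup$ iff $\bigcup_{\Sigma'\in\mathrm{Sing}(\Sigma_\mathcal{T})}\Sigma'$ is MFA. -}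

module Defs where

open import Level using (Level)
open import Data.Nat using (ℕ; zero; suc; _+_; _≤_; _⊔_)
open import Data.Nat.Properties using (_≟_)
open import Data.List using (List; []; _∷_; map; concatMap; _++_; length; upTo; zip)
open import Data.List.Membership.Propositional using (_∈_; _∉_)
open import Data.List.Relation.Unary.All using (All)
open import Data.List.Relation.Binary.Pointwise using (Pointwise)
open import Data.Fin using (Fin; inject₁; fromℕ) renaming (suc to fsuc)
open import Data.Product using (Σ; ∃; _×_; _,_)
open import Data.Sum using (_⊎_)
open import Data.Empty using (⊥)
open import Data.Unit using () renaming (⊤ to Unit)
open import Relation.Nullary using (¬_; yes; no)
open import Relation.Binary.PropositionalEquality using (_≡_; _≢_)
open import Relation.Binary.Structures using (IsStrictTotalOrder)
open import Data.List.Membership.DecPropositional _≟_ using () renaming (_∈?_ to _∈ℕ?_)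

data Concept : Set where
  top bot : Concept
  cn      : ℕ → Concept

RoleName : Set
RoleName = ℕ

data Pred : Set where
  con : Concept → Pred
  rol : RoleName → Pred
  eqP : Pred

arity : Pred → ℕ
arity (con _) = 1
arity (rol _) = 2
arity eqP     = 2

Var : Set
Var = ℕ

record VAtom : Set where
  constructor _⦅_⦆
  field
    pred : Pred
    vars : List Var
open VAtom public

-- tgd body ∃-vars head  :  body → ∃ ex . head
-- egd body x y          :  body → x ≈ y
data Rule : Set where
  tgd : List VAtom → List Var → List VAtom → Rule
  egd : List VAtom → Var → Var → Rule

body : Rule → List VAtom
body (tgd b _ _) = b
body (egd b _ _) = b

data IsExTGD : Rule → Set where
  isEx : ∀ {b y ys h} → IsExTGD (tgd b (y ∷ ys) h)

data IsFullTGD : Rule → Set where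
  isFull : ∀ {b h} → IsFullTGD (tgd b [] h)

data IsTGD : Rule → Set where
  isTGD : ∀ {b ys h} → IsTGD (tgd b ys h)

data IsEGD : Rule → Set where
  isEGD : ∀ {b x y} → IsEGD (egd b x y)

-- Ground terms. The Skolem symbol f^y_ρ is represented by the pair (ρ , y);
-- its arguments are the images of the frontier variables of ρ.

data Term : Set where
  star : Term
  fn   : Rule → Var → List Term → Term

mutual
  dep : Term → ℕ
  dep star         = 0
  dep (fn _ _ ts)  = suc (depL ts)

  depL : List Term → ℕ
  depL []       = 0
  depL (t ∷ ts) = dep t ⊔ depL ts

data _⊑_ : Term → Term → Set where
  ⊑-refl : ∀ {t} → t ⊑ t
  ⊑-arg  : ∀ {t s ρ y ts} → t ⊑ s → s ∈ ts → t ⊑ fn ρ y ts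

_⊏_ : Term → Term → Set
t ⊏ u = t ⊑ u × t ≢ u

Cyclic : ℕ → Term → Set
Cyclic n t =
  Σ Rule λ ρ → Σ Var λ y → Σ (Fin (suc n) → List Term) λ ss →
    (fn ρ y (ss (fromℕ n)) ⊑ t) ×
    (∀ (i : Fin n) → fn ρ y (ss (inject₁ i)) ⊏ fn ρ y (ss (fsuc i)))

record Fact : Set where
  constructor _⟨_⟩
  field
    fpred : Pred
    args  : List Term
open Fact public

FSet : Set₁
FSet = Fact → Set

_≐_ : FSet → FSet → Set
F ≐ G = ∀ φ → (F φ → G φ) × (G φ → F φ)

OccursIn : Term → Fact → Set
OccursIn t φ = t ∈ args φ

RSet : Set₁
RSet = Rule → Set

Subst : Set
Subst = Var → Term

inst : Subst → VAtom → Fact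
inst σ a = pred a ⟨ map σ (vars a) ⟩

Match : ∀ {ℓ} → List VAtom → Subst → (Fact → Set ℓ) → Set ℓ
Match b σ F = All (λ a → F (inst σ a)) b

-- frontier of a TGD: head variables that are not existential (in head order)
frontier : List Var → List VAtom → List Var
frontier ex h = go (concatMap vars h)
  where
  go : List Var → List Var
  go [] = []
  go (v ∷ vs) with v ∈ℕ? ex
  ... | yes _ = go vs
  ... | no  _ = v ∷ go vs

skσ : Rule → Subst → Subst
skσ (tgd b ex h) σ v with v ∈ℕ? ex
... | yes _ = fn (tgd b ex h) v (map σ (frontier ex h))
... | no  _ = σ v
skσ (egd _ _ _) σ v = σ v

InSkHead : Rule → Subst → Fact → Set
InSkHead (tgd b ex h) σ φ = φ ∈ map (inst (skσ (tgd b ex h) σ)) h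
InSkHead (egd _ _ _)  σ φ = ⊥

RApp : Rule → FSet → FSet
RApp (tgd b ex h) F φ =
  Σ Subst λ σ → Match b σ F × InSkHead (tgd b ex h) σ φ ×
    ¬ (Σ Subst λ τ → (∀ v → v ∉ ex → τ v ≡ σ v) × Match h τ F)
RApp (egd _ _ _) F φ = ⊥

RAppSet : RSet → FSet → FSet
RAppSet Rs F φ = F φ ⊎ (Σ Rule λ ρ → Rs ρ × RApp ρ F φ)

-- A total strict order ≺ on terms with t ≺ u only if dep t ≤ dep u
-- (t ≺ u is read "t is greater than u").
record TermOrder : Set₁ where
  field
    _≺_   : Term → Term → Set
    isSTO : IsStrictTotalOrder _≡_ _≺_
    ≺-dep : ∀ {t u} → t ≺ u → dep t ≤ dep u

module _ (O : TermOrder) where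
  open TermOrder O

  data Cong (Es : RSet) (F : FSet) : Term → Term → Set where
    gen   : ∀ {b x y} → Es (egd b x y) → (σ : Subst) → Match b σ F →
            Cong Es F (σ x) (σ y)
    c-refl  : ∀ {t} → Cong Es F t t
    c-sym   : ∀ {t u} → Cong Es F t u → Cong Es F u t
    c-trans : ∀ {t u v} → Cong Es F t u → Cong Es F u v → Cong Es F t v
    c-cong  : ∀ {ρ y ts us} → Pointwise (Cong Es F) ts us →
              Cong Es F (fn ρ y ts) (fn ρ y us)

  Rep : RSet → FSet → Term → Term → Set
  Rep Es F t u = Cong Es F t u × (∀ v → Cong Es F t v → v ≡ u ⊎ u ≺ v)

  EApp : RSet → FSet → FSet
  EApp Es F φ = Σ Fact λ ψ → F ψ × fpred ψ ≡ fpred φ ×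
                  Pointwise (Rep Es F) (args ψ) (args φ)

  module _ (Rs : RSet) (I : FSet) where
    Rs≈ Rs∀ Rs∃ : RSet
    Rs≈ ρ = Rs ρ × IsEGD ρ
    Rs∀ ρ = Rs ρ × IsFullTGD ρ
    Rs∃ ρ = Rs ρ × IsExTGD ρ

    IsChaseStep : FSet → FSet → Set
    IsChaseStep F G =
      (¬ (EApp Rs≈ F ≐ F) × (G ≐ EApp Rs≈ F)) ⊎
      ((EApp Rs≈ F ≐ F) × ¬ (RAppSet Rs∀ F ≐ F) × (G ≐ RAppSet Rs∀ F)) ⊎
      ((EApp Rs≈ F ≐ F) × (RAppSet Rs∀ F ≐ F) × (G ≐ RAppSet Rs∃ F))

    IsChaseSeq : (ℕ → FSet) → Set
    IsChaseSeq seq = (seq 0 ≐ I) × (∀ i → IsChaseStep (seq i) (seq (suc i)))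

    ReplacedIn : (ℕ → FSet) → Term → Term → Set
    ReplacedIn seq s v = Σ ℕ λ i →
      ¬ (EApp Rs≈ (seq i) ≐ seq i) × Rep Rs≈ (seq i) s v × s ≢ v

    data ReplacedBy (seq : ℕ → FSet) : Term → Term → Set where
      rb-refl : ∀ {s} → ReplacedBy seq s s
      rb-step : ∀ {s u v} → ReplacedIn seq s u → ReplacedBy seq u v →
                ReplacedBy seq s v

    Bracket : (ℕ → FSet) → Term → Term → Set
    Bracket seq s v = ReplacedBy seq s v × ¬ (Σ Term λ w → ReplacedIn seq v w)

data Axiom : Set where
  conjAx   : Concept → List Concept → Concept → Axiom   -- A₁ ⊓ … ⊓ Aₙ ⊑ B (n ≥ 1)
  forallAx : Concept → RoleName → Concept → Axiom        -- A ⊑ ∀R.B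
  atMostAx : Concept → RoleName → Concept → Axiom        -- A ⊑ ≤1 R.B
  existsAx : Concept → RoleName → Concept → Axiom        -- A ⊑ ∃R.B
  subAx    : RoleName → RoleName → Axiom                 -- S ⊑ R
  invAx    : RoleName → RoleName → Axiom                 -- S⁻ ⊑ R
  chainAx  : RoleName → RoleName → RoleName → Axiom      -- S ∘ V ⊑ R

TBox : Set
TBox = List Axiom

data RoleExpr : Set where
  nm  : RoleName → RoleExpr
  inv : RoleName → RoleExpr

Inv : RoleExpr → RoleExpr
Inv (nm r)  = inv r
Inv (inv r) = nm r

RegularWrt : (RoleExpr → RoleExpr → Set) → Axiom → Set
RegularWrt _<_ (subAx S R)     = nm S < nm R
RegularWrt _<_ (invAx S R)     = (S ≡ R) ⊎ (inv S < nm R)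
RegularWrt _<_ (chainAx S V R) =
  (S ≡ R × V ≡ R) ⊎ (S ≡ R × nm V < nm R) ⊎ (nm S < nm R × V ≡ R) ⊎
  (nm S < nm R × nm V < nm R)
RegularWrt _<_ _ = Unit

Regular : TBox → Set₁
Regular T = Σ (RoleExpr → RoleExpr → Set) λ _<_ →
  (∀ {r} → ¬ (r < r)) ×
  (∀ {r s t} → r < s → s < t → r < t) ×
  (∀ {r s} → (r < s → Inv r < s) × (Inv r < s → r < s)) ×
  All (RegularWrt _<_) T

data NonSimple (T : TBox) : RoleName → Set where
  ns-chain : ∀ {S V R} → chainAx S V R ∈ T → NonSimple T R
  ns-sub   : ∀ {S R} → subAx S R ∈ T → NonSimple T S → NonSimple T R
  ns-inv   : ∀ {S R} → invAx S R ∈ T → NonSimple T S → NonSimple T R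

SimpleInNR : TBox → Set
SimpleInNR T = ∀ {A R B} → atMostAx A R B ∈ T → ¬ NonSimple T R

HornSRIQ : TBox → Set₁
HornSRIQ T = Regular T × SimpleInNR T

-- Translation 𝓡_𝓣   (variables x = 0, y = 1, z = 2)

cAt : Concept → Var → VAtom
cAt A v = con A ⦅ v ∷ [] ⦆

rAt : RoleName → Var → Var → VAtom
rAt R v w = rol R ⦅ v ∷ w ∷ [] ⦆

exRule : Concept → RoleName → Concept → Rule
exRule A R B = tgd (cAt A 0 ∷ []) (1 ∷ []) (rAt R 0 1 ∷ cAt B 1 ∷ [])

tr : Axiom → Rule
tr (conjAx A As B)  = tgd (map (λ C → cAt C 0) (A ∷ As)) [] (cAt B 0 ∷ [])
tr (forallAx A R B) = tgd (cAt A 0 ∷ rAt R 0 1 ∷ []) [] (cAt B 1 ∷ [])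
tr (atMostAx A R B) = egd (cAt A 0 ∷ rAt R 0 1 ∷ cAt B 1 ∷ rAt R 0 2 ∷ cAt B 2 ∷ []) 1 2
tr (existsAx A R B) = exRule A R B
tr (subAx S R)      = tgd (rAt S 0 1 ∷ []) [] (rAt R 0 1 ∷ [])
tr (invAx S R)      = tgd (rAt S 1 0 ∷ []) [] (rAt R 0 1 ∷ [])
tr (chainAx S V R)  = tgd (rAt S 0 1 ∷ rAt V 1 2 ∷ []) [] (rAt R 0 2 ∷ [])

predsAx : Axiom → List Pred
predsAx (conjAx A As B)  = con B ∷ map con (A ∷ As)
predsAx (forallAx A R B) = con A ∷ rol R ∷ con B ∷ []
predsAx (atMostAx A R B) = con A ∷ rol R ∷ con B ∷ []
predsAx (existsAx A R B) = con A ∷ rol R ∷ con B ∷ []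
predsAx (subAx S R)      = rol S ∷ rol R ∷ []
predsAx (invAx S R)      = rol S ∷ rol R ∷ []
predsAx (chainAx S V R)  = rol S ∷ rol V ∷ rol R ∷ []

topRule : Pred → Rule
topRule (con A) = tgd (cAt A 0 ∷ []) [] (cAt top 0 ∷ [])
topRule (rol R) = tgd (rAt R 0 1 ∷ []) [] (cAt top 0 ∷ cAt top 1 ∷ [])
topRule eqP     = tgd ((eqP ⦅ 0 ∷ 1 ∷ [] ⦆) ∷ []) [] (cAt top 0 ∷ cAt top 1 ∷ [])

RT : TBox → List Rule
RT T = map tr T ++ map topRule (concatMap predsAx T)

RTset : TBox → RSet
RTset T ρ = ρ ∈ RT T

data PredIn (p : Pred) : Rule → Set where
  inBodyT : ∀ {b ex h} → p ∈ map pred b → PredIn p (tgd b ex h)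
  inHeadT : ∀ {b ex h} → p ∈ map pred h → PredIn p (tgd b ex h)
  inBodyE : ∀ {b x y}  → p ∈ map pred b → PredIn p (egd b x y)

replicate : ℕ → Term → List Term
replicate zero    t = []
replicate (suc n) t = t ∷ replicate n t

Critical : RSet → FSet
Critical Rs φ = Σ Rule λ ρ → Rs ρ × PredIn (fpred φ) ρ ×
                  args φ ≡ replicate (arity (fpred φ)) star

module _ (O : TermOrder) (T : TBox) where

  data 𝓘 (t : Term) : FSet where
    𝓘-A   : ∀ {A R B s} → exRule A R B ∈ RT T → t ≡ fn (exRule A R B) 1 (s ∷ []) →
            𝓘 t (con A ⟨ s ∷ [] ⟩)
    𝓘-R   : ∀ {A R B s} → exRule A R B ∈ RT T → t ≡ fn (exRule A R B) 1 (s ∷ []) →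
            𝓘 t (rol R ⟨ s ∷ t ∷ [] ⟩)
    𝓘-B   : ∀ {A R B s} → exRule A R B ∈ RT T → t ≡ fn (exRule A R B) 1 (s ∷ []) →
            𝓘 t (con B ⟨ t ∷ [] ⟩)
    𝓘-rec : ∀ {A R B s φ} → exRule A R B ∈ RT T → t ≡ fn (exRule A R B) 1 (s ∷ []) →
            𝓘 s φ → 𝓘 t φ

  RTrules : RSet
  RTrules ρ = ρ ∈ RT T × (IsFullTGD ρ ⊎ IsEGD ρ)

  -- f^y_ρ(s), ρ = A(x) → ∃y[R(x,y) ∧ B(y)], is restricted w.r.t. 𝓣
  -- (rChase(RT(𝓣,s)) = ⋃ᵢ Fᵢ for the restricted chase sequence (Fᵢ))
  Restricted : Concept → RoleName → Concept → Term → Set₁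
  Restricted A R B s =
    Σ (ℕ → FSet) λ seq → IsChaseSeq O RTrules (𝓘 s) seq ×
      Σ Term λ v → Bracket O RTrules (𝓘 s) seq s v ×
      Σ Term λ u → (Σ ℕ λ i → seq i (rol R ⟨ v ∷ u ∷ [] ⟩)) ×
                   (Σ ℕ λ j → seq j (con B ⟨ u ∷ [] ⟩))

  ReplaceAll : Term → Term → List Term → List Term → Set
  ReplaceAll u t = Pointwise (λ w w' → (w ≡ u × w' ≡ t) ⊎ (w ≢ u × w' ≡ w))

  TGDs : RSet
  TGDs ρ = ρ ∈ RT T × IsTGD ρ

  data 𝓥 : Fact → Set₁ where
    v-crit : ∀ {φ} → Critical TGDs φ → 𝓥 φ
    v-∀    : ∀ {b h φ} → tgd b [] h ∈ RT T → (σ : Subst) → Match b σ 𝓥 →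
             φ ∈ map (inst σ) h → 𝓥 φ
    v-∃R   : ∀ {A R B t} → exRule A R B ∈ RT T → 𝓥 (con A ⟨ t ∷ [] ⟩) →
             ¬ Restricted A R B t →
             𝓥 (rol R ⟨ t ∷ fn (exRule A R B) 1 (t ∷ []) ∷ [] ⟩)
    v-∃B   : ∀ {A R B t} → exRule A R B ∈ RT T → 𝓥 (con A ⟨ t ∷ [] ⟩) →
             ¬ Restricted A R B t →
             𝓥 (con B ⟨ fn (exRule A R B) 1 (t ∷ []) ∷ [] ⟩)
    v-≈₁   : ∀ {b x y} → egd b x y ∈ RT T → (σ : Subst) → Match b σ 𝓥 →
             𝓥 (eqP ⟨ σ x ∷ σ y ∷ [] ⟩)
    v-≈₂   : ∀ {b x y} → egd b x y ∈ RT T → (σ : Subst) → Match b σ 𝓥 →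
             𝓥 (eqP ⟨ σ y ∷ σ x ∷ [] ⟩)
    v-Eq   : ∀ {t u p us us'} → 𝓥 (eqP ⟨ t ∷ u ∷ [] ⟩) → 𝓥 (p ⟨ us ⟩) →
             p ≢ eqP → dep t ≤ dep u → u ∈ us → ReplaceAll u t us us' →
             𝓥 (p ⟨ us' ⟩)

  RCA : ℕ → Set₁
  RCA n = ¬ (Σ Fact λ φ → Σ Term λ t → 𝓥 φ × OccursIn t φ × Cyclic n t)

data OChase (Rs : RSet) : FSet where
  oc-crit : ∀ {φ} → Critical Rs φ → OChase Rs φ
  oc-app  : ∀ {b ex h φ} → Rs (tgd b ex h) → (σ : Subst) → Match b σ (OChase Rs) →
            InSkHead (tgd b ex h) σ φ → OChase Rs φ

MFA : RSet → Set
MFA Rs = ¬ (Σ Fact λ φ → Σ Term λ t → OChase Rs φ × OccursIn t φ × Cyclic 1 t)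

toTGD : Rule → Rule
toTGD (egd b x y)  = tgd b [] ((eqP ⦅ x ∷ y ∷ [] ⦆) ∷ [])
toTGD r            = r

SigmaT : TBox → List Rule
SigmaT T = map toTGD (RT T)

eqAt : Var → Var → VAtom
eqAt v w = eqP ⦅ v ∷ w ∷ [] ⦆

EqRules : List Rule
EqRules =
  tgd (cAt top 0 ∷ []) [] (eqAt 0 0 ∷ []) ∷
  tgd (eqAt 0 1 ∷ []) [] (eqAt 1 0 ∷ []) ∷
  tgd (eqAt 0 2 ∷ eqAt 2 1 ∷ []) [] (eqAt 0 1 ∷ []) ∷ []

-- Singularization (canonical fresh names): the k-th variable occurrence in
-- the body (k = 0,1,…,m-1) becomes the fresh variable k; existential variable
-- y becomes m + y; the choice function c picks, for each body variable v,
-- the index c v of one of its occurrences (the chosen v_j).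
occs : List VAtom → List Var
occs = concatMap vars

renameBody : ℕ → List VAtom → List VAtom
renameBody k []       = []
renameBody k (a ∷ as) =
  (pred a ⦅ map (k +_) (upTo (length (vars a))) ⦆) ∷ renameBody (k + length (vars a)) as

ValidChoice : List VAtom → (Var → ℕ) → Set
ValidChoice b c = ∀ v → v ∈ occs b → (c v , v) ∈ zip (upTo (length (occs b))) (occs b)

sing : Rule → (Var → ℕ) → Rule
sing (tgd b ex h) c =
  tgd (renameBody 0 b ++ map (λ kv → eqAt (Data.Product.proj₁ kv) (c (Data.Product.proj₂ kv)))
                              (zip (upTo m) (occs b)))
      (map (m +_) ex)
      (map (λ a → pred a ⦅ map ren (vars a) ⦆) h)
  where
  m = length (occs b)
  ren : Var → Var
  ren v with v ∈ℕ? ex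
  ... | yes _ = m + v
  ... | no  _ = c v
sing r c = r

SingUnion : TBox → RSet
SingUnion T ρ' = (ρ' ∈ EqRules) ⊎
  (Σ Rule λ ρ → ρ ∈ SigmaT T × Σ (Var → ℕ) λ c → ValidChoice (body ρ) c × ρ' ≡ sing ρ c)

MFA∪ : TBox → Set
MFA∪ T = MFA (SingUnion T)

module Submission where

-- The witness is the TBox  T₀ = { A ⊑ ∃R.⊤ , A ⊑ ≤1 R.⊤ , ⊤ ⊓ D ⊑ A }.
--
-- T₀ is RCA₁.  In 𝓥_T₀ every term has depth at most 1, and the named
-- concepts A and D only hold of depth-0 terms.  This invariant survives every
-- expansion rule; the crucial case is the Eq-rule, which replaces a term only
-- by one of no greater depth, so Eq(⋆, f(⋆)) never transfers A to f(⋆).  As a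
-- 1-cyclic term has depth at least 2, no cyclic term occurs in 𝓥_T₀.
--
-- T₀ is not MFA∪.  Singularization separates the two occurrences of x in
-- ⊤(x) ∧ D(x) → A(x): from ⊤(f(⋆)), D(⋆) and Eq(⋆, f(⋆)) (the latter given by
-- the singularized ≤1-rule from R(⋆,⋆) and R(⋆,f(⋆))) the oblivious chase
-- derives A(f(⋆)) and hence R(f(⋆), f(f(⋆))), which contains a cyclic term.

open import Defs
open import Data.Product using (Σ; _×_; _,_; proj₂)
open import Data.Product using () renaming (map₂ to mapΣ₂)
open import Relation.Nullary using (¬_; contradiction)
open import Data.Nat using (ℕ; suc; _≤_; _<_; z≤n; s≤s)
open import Data.Nat.Properties
  using (≤-refl; ≤-trans; m≤m⊔n; m≤n⊔m; m≤n⇒m≤1+n; ⊔-lub; <⇒≱)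
open import Data.List using (List; []; _∷_; map)
open import Data.List.Relation.Unary.All as All using (All; []; _∷_)
open import Data.List.Relation.Unary.Any using (here; there)
open import Data.List.Relation.Binary.Pointwise using ([]; _∷_)
open import Data.List.Membership.Propositional using (_∈_; _∉_)
open import Data.List.Membership.Propositional.Properties using (∈-map⁻; ∈-++⁻)
open import Data.Sum using (_⊎_; inj₁; inj₂)
open import Data.Empty using (⊥)
open import Data.Unit using (tt)
open import Data.Fin using (Fin; toℕ; fromℕ; inject₁) renaming (zero to fzero; suc to fsuc)
open import Data.Fin.Properties using (toℕ-fromℕ; toℕ-inject₁)
open import Data.Fin.Induction using (<-weakInduction)
open import Relation.Binary.PropositionalEquality using (_≡_; refl; subst)

∈⇒dep≤depL : ∀ {s ts} → s ∈ ts → dep s ≤ depL ts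
∈⇒dep≤depL {ts = t ∷ ts} (here refl) = m≤m⊔n (dep t) (depL ts)
∈⇒dep≤depL {ts = t ∷ ts} (there s∈ts) =
  ≤-trans (∈⇒dep≤depL s∈ts) (m≤n⊔m (dep t) (depL ts))

⊑⇒dep≤ : ∀ {t u} → t ⊑ u → dep t ≤ dep u
⊑⇒dep≤ ⊑-refl = ≤-refl
⊑⇒dep≤ (⊑-arg t⊑s s∈ts) = m≤n⇒m≤1+n (≤-trans (⊑⇒dep≤ t⊑s) (∈⇒dep≤depL s∈ts))

⊏⇒dep< : ∀ {t u} → t ⊏ u → dep t < dep u
⊏⇒dep< (⊑-refl , t≢t) = contradiction refl t≢t
⊏⇒dep< (⊑-arg t⊑s s∈ts , _) = s≤s (≤-trans (⊑⇒dep≤ t⊑s) (∈⇒dep≤depL s∈ts))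

-- an n-cyclic term has depth greater than n: its chain f(s₁) ⊏ … ⊏ f(sₙ₊₁)
-- starts at depth ≥ 1 and gains depth at every step
cyclic⇒n<dep : ∀ {n t} → Cyclic n t → n < dep t
cyclic⇒n<dep {n} (ρ , y , ss , last⊑t , chain) =
  ≤-trans (subst (_< depAt (fromℕ n)) (toℕ-fromℕ n) (chain-depth (fromℕ n))) (⊑⇒dep≤ last⊑t)
  where
  depAt : Fin (suc n) → ℕ
  depAt i = dep (fn ρ y (ss i))

  Deep : Fin (suc n) → Set
  Deep i = toℕ i < depAt i

  step : ∀ i → Deep (inject₁ i) → Deep (fsuc i)
  step i deep = ≤-trans (s≤s (subst (_< depAt (inject₁ i)) (toℕ-inject₁ i) deep)) (⊏⇒dep< (chain i))

  chain-depth : ∀ i → Deep i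
  chain-depth = <-weakInduction Deep (s≤s z≤n) step

rule-origin : ∀ {T ρ} → ρ ∈ RT T →
  (Σ Axiom λ ax → ax ∈ T × ρ ≡ tr ax) ⊎ (Σ Pred λ p → ρ ≡ topRule p)
rule-origin {T} ρ∈ with ∈-++⁻ (map tr T) ρ∈
... | inj₁ ρ∈tr  = inj₁ (∈-map⁻ tr ρ∈tr)
... | inj₂ ρ∈top = inj₂ (mapΣ₂ proj₂ (∈-map⁻ topRule ρ∈top))

topRule-full : ∀ p → IsFullTGD (topRule p)
topRule-full (con _) = isFull
topRule-full (rol _) = isFull
topRule-full eqP     = isFull

axiom-origin : ∀ {T ρ} → ρ ∈ RT T → ¬ IsFullTGD ρ → Σ Axiom λ ax → ax ∈ T × ρ ≡ tr ax
axiom-origin ρ∈ not-full with rule-origin ρ∈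
... | inj₁ origin     = origin
... | inj₂ (p , refl) = contradiction (topRule-full p) not-full

-- non-simple roles stem from role chains, so without chains all roles are simple
no-chain⇒simple : ∀ {T} → (∀ {S V R} → chainAx S V R ∉ T) → ∀ {R} → ¬ NonSimple T R
no-chain⇒simple no-chain (ns-chain S∘V⊑R) = no-chain S∘V⊑R
no-chain⇒simple no-chain (ns-sub _ ns)    = no-chain⇒simple no-chain ns
no-chain⇒simple no-chain (ns-inv _ ns)    = no-chain⇒simple no-chain ns

replace-preserves : ∀ O T {P : Term → Set} {u t us us'} →
  All P us → P t → ReplaceAll O T u t us us' → All P us'
replace-preserves O T [] _ [] = []
replace-preserves O T (_ ∷ Pus) Pt (inj₁ (_ , refl) ∷ r) = Pt ∷ replace-preserves O T Pus Pt r
replace-preserves O T (Pw ∷ Pus) Pt (inj₂ (_ , refl) ∷ r) = Pw ∷ replace-preserves O T Pus Pt r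

conceptA conceptD : Concept
conceptA = cn 0
conceptD = cn 1

roleR : RoleName
roleR = 0

ax∃ ax≤1 ax⊓ : Axiom
ax∃  = existsAx conceptA roleR top
ax≤1 = atMostAx conceptA roleR top
ax⊓  = conjAx top (conceptD ∷ []) conceptA

T₀ : TBox
T₀ = ax∃ ∷ ax≤1 ∷ ax⊓ ∷ []

-- T₀ has no role axioms: the empty order on roles witnesses regularity, and
-- without role chains every role is simple
T₀-Horn : HornSRIQ T₀
T₀-Horn = ((λ _ _ → ⊥) , (λ ()) , (λ ()) , ((λ ()) , (λ ())) , (tt ∷ tt ∷ tt ∷ [])) ,
          (λ _ → no-chain⇒simple no-chain)
  where
  no-chain : ∀ {S V R} → chainAx S V R ∉ T₀
  no-chain (there (there (there ())))

T₀-existential : ∀ {A R B} → exRule A R B ∈ RT T₀ → A ≡ conceptA × B ≡ top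
T₀-existential ρ∈ with axiom-origin {T₀} ρ∈ (λ ())
... | _ , here refl , refl = refl , refl
... | _ , there (here refl) , ()
... | _ , there (there (here refl)) , ()

T₀-egd : ∀ {b x y} → egd b x y ∈ RT T₀ → egd b x y ≡ tr ax≤1
T₀-egd ρ∈ with axiom-origin {T₀} ρ∈ (λ ())
... | _ , here refl , ()
... | _ , there (here refl) , refl = refl
... | _ , there (there (here refl)) , ()

T₀-full : ∀ {b h} → tgd b [] h ∈ RT T₀ →
  tgd b [] h ≡ tr ax⊓ ⊎ (Σ Pred λ p → tgd b [] h ≡ topRule p)
T₀-full ρ∈ with rule-origin {T₀} ρ∈
... | inj₁ (_ , here refl , ())
... | inj₁ (_ , there (here refl) , ())
... | inj₁ (_ , there (there (here refl)) , refl) = inj₁ refl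
... | inj₂ top-rule = inj₂ top-rule

-- T₀ is RCA₁

bound : Pred → ℕ
bound (con (cn _)) = 0
bound _            = 1

bound≤1 : ∀ p → bound p ≤ 1
bound≤1 (con top)    = ≤-refl
bound≤1 (con bot)    = ≤-refl
bound≤1 (con (cn _)) = z≤n
bound≤1 (rol _)      = ≤-refl
bound≤1 eqP          = ≤-refl

Shallow : Fact → Set
Shallow φ = All (λ t → dep t ≤ bound (fpred φ)) (args φ)

critical-shallow : ∀ {φ} → args φ ≡ replicate (arity (fpred φ)) star → Shallow φ
critical-shallow {p ⟨ _ ⟩} refl = stars (arity p)
  where
  stars : ∀ k → All (λ t → dep t ≤ bound p) (replicate k star)
  stars 0       = []
  stars (suc k) = z≤n ∷ stars k

-- a list of depth-0 terms has depth 0, so a Skolem term over it has depth 1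
depL-flat : ∀ {ts} → All (λ t → dep t ≤ 0) ts → depL ts ≤ 0
depL-flat []       = z≤n
depL-flat (d ∷ ds) = ⊔-lub d (depL-flat ds)

-- the ⊤-rules only copy arguments into ⊤, whose bound is maximal
topRule-shallow : ∀ {b h σ φ} p → tgd b [] h ≡ topRule p →
  Match b σ Shallow → φ ∈ map (inst σ) h → Shallow φ
topRule-shallow (con A) refl ((d ∷ []) ∷ []) (here refl) = ≤-trans d (bound≤1 (con A)) ∷ []
topRule-shallow (rol _) refl ((d ∷ _ ∷ []) ∷ []) (here refl)         = d ∷ []
topRule-shallow (rol _) refl ((_ ∷ d ∷ []) ∷ []) (there (here refl)) = d ∷ []
topRule-shallow eqP     refl ((d ∷ _ ∷ []) ∷ []) (here refl)         = d ∷ []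
topRule-shallow eqP     refl ((_ ∷ d ∷ []) ∷ []) (there (here refl)) = d ∷ []

-- A(x) is only derived from D(x), whose argument has depth 0
full-shallow : ∀ {b h σ φ} → tgd b [] h ≡ tr ax⊓ ⊎ (Σ Pred λ p → tgd b [] h ≡ topRule p) →
  Match b σ Shallow → φ ∈ map (inst σ) h → Shallow φ
full-shallow (inj₁ refl) (_ ∷ D-fact ∷ []) (here refl) = D-fact
full-shallow (inj₂ (p , eq)) body φ∈ = topRule-shallow p eq body φ∈

module _ (O : TermOrder) where

  mutual
    shallow : ∀ {φ} → 𝓥 O T₀ φ → Shallow φ
    shallow (v-crit (_ , _ , _ , crit)) = critical-shallow crit
    shallow (v-∀ ρ∈ _ body φ∈) = full-shallow (T₀-full ρ∈) (shallow-body body) φ∈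
    shallow (v-∃R ρ∈ A-fact _) with T₀-existential ρ∈ | shallow A-fact
    ... | refl , refl | A-args@(d ∷ []) = m≤n⇒m≤1+n d ∷ s≤s (depL-flat A-args) ∷ []
    shallow (v-∃B ρ∈ A-fact _) with T₀-existential ρ∈ | shallow A-fact
    ... | refl , refl | A-args = s≤s (depL-flat A-args) ∷ []
    shallow (v-≈₁ ρ∈ _ body) with T₀-egd ρ∈ | shallow-body body
    ... | refl | _ ∷ _ ∷ (dy ∷ []) ∷ _ ∷ (dz ∷ []) ∷ [] = dy ∷ dz ∷ []
    shallow (v-≈₂ ρ∈ _ body) with T₀-egd ρ∈ | shallow-body body
    ... | refl | _ ∷ _ ∷ (dy ∷ []) ∷ _ ∷ (dz ∷ []) ∷ [] = dz ∷ dy ∷ []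
    -- t replaces u only if dep t ≤ dep u, and u already respects the bound
    shallow (v-Eq _ fact _ t≤u u∈us r) =
      replace-preserves O T₀ (shallow fact) (≤-trans t≤u (All.lookup (shallow fact) u∈us)) r

    shallow-body : ∀ {b σ} → Match b σ (𝓥 O T₀) → Match b σ Shallow
    shallow-body []       = []
    shallow-body (f ∷ fs) = shallow f ∷ shallow-body fs

  -- terms of 𝓥_T₀ have depth ≤ 1, cyclic terms depth ≥ 2
  T₀-RCA₁ : RCA O T₀ 1
  T₀-RCA₁ (φ , t , φ∈𝓥 , t∈φ , cyclic) =
    <⇒≱ (cyclic⇒n<dep cyclic)
        (≤-trans (All.lookup (shallow φ∈𝓥) t∈φ) (bound≤1 (fpred φ)))

-- T₀ is not MFA∪

singularized : ∀ {ρ} c → ρ ∈ SigmaT T₀ → ValidChoice (body ρ) c → SingUnion T₀ (sing ρ c)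
singularized c ρ∈ valid = inj₂ (_ , ρ∈ , c , valid , refl)

-- choice of occurrence for each body variable: the first one, and for the
-- ≤1-rule the occurrences x₂ of y and x₅ of z (body occurrences 0,0,1,1,0,2,2)
first-occurrence choice≤1 : Var → ℕ
first-occurrence _ = 0
choice≤1 1 = 2
choice≤1 2 = 5
choice≤1 _ = 0

-- A(x₀) ∧ Eq(x₀,x₀) → ∃y [R(x₀,y) ∧ ⊤(y)]
sing∃ : Rule
sing∃ = sing (tr ax∃) first-occurrence

-- A(x₀) ∧ R(x₁,x₂) ∧ ⊤(x₃) ∧ R(x₄,x₅) ∧ ⊤(x₆) ∧ Eq(x₀,x₀) ∧ Eq(x₁,x₀) ∧ Eq(x₂,x₂)
--   ∧ Eq(x₃,x₂) ∧ Eq(x₄,x₀) ∧ Eq(x₅,x₅) ∧ Eq(x₆,x₅) → Eq(x₂,x₅)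
sing≤1 : Rule
sing≤1 = sing (toTGD (tr ax≤1)) choice≤1

-- ⊤(x₀) ∧ D(x₁) ∧ Eq(x₀,x₀) ∧ Eq(x₁,x₀) → A(x₀)
sing⊓ : Rule
sing⊓ = sing (tr ax⊓) first-occurrence

sing∃∈ : SingUnion T₀ sing∃
sing∃∈ = singularized first-occurrence (here refl) λ { _ (here refl) → here refl }

sing≤1∈ : SingUnion T₀ sing≤1
sing≤1∈ = singularized choice≤1 (there (here refl)) λ
  { _ (here refl)                                         → here refl
  ; _ (there (here refl))                                 → here refl
  ; _ (there (there (here refl)))                         → there (there (here refl))
  ; _ (there (there (there (here refl))))                 → there (there (here refl))
  ; _ (there (there (there (there (here refl)))))         → here refl
  ; _ (there (there (there (there (there (here refl)))))) → there (there (there (there (there (here refl)))))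
  ; _ (there (there (there (there (there (there (here refl))))))) →
      there (there (there (there (there (here refl)))))
  }

sing⊓∈ : SingUnion T₀ sing⊓
sing⊓∈ = singularized first-occurrence (there (there (here refl))) λ
  { _ (here refl)         → here refl
  ; _ (there (here refl)) → here refl
  }

eq-refl∈ : SingUnion T₀ (tgd (cAt top 0 ∷ []) [] (eqAt 0 0 ∷ []))
eq-refl∈ = inj₁ (here refl)

f : Term → Term
f t = fn sing∃ 2 (t ∷ [])

Chase : Fact → Set
Chase = OChase (SingUnion T₀)

A⋆ : Chase (con conceptA ⟨ star ∷ [] ⟩)
A⋆ = oc-crit (sing∃ , sing∃∈ , inBodyT (here refl) , refl)

Eq⋆ : Chase (eqP ⟨ star ∷ star ∷ [] ⟩)
Eq⋆ = oc-crit (sing∃ , sing∃∈ , inBodyT (there (here refl)) , refl)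

R⋆ : Chase (rol roleR ⟨ star ∷ star ∷ [] ⟩)
R⋆ = oc-crit (sing∃ , sing∃∈ , inHeadT (here refl) , refl)

⊤⋆ : Chase (con top ⟨ star ∷ [] ⟩)
⊤⋆ = oc-crit (sing∃ , sing∃∈ , inHeadT (there (here refl)) , refl)

D⋆ : Chase (con conceptD ⟨ star ∷ [] ⟩)
D⋆ = oc-crit (sing⊓ , sing⊓∈ , inBodyT (there (here refl)) , refl)

R⋆f⋆ : Chase (rol roleR ⟨ star ∷ f star ∷ [] ⟩)
R⋆f⋆ = oc-app sing∃∈ (λ _ → star) (A⋆ ∷ Eq⋆ ∷ []) (here refl)

⊤f⋆ : Chase (con top ⟨ f star ∷ [] ⟩)
⊤f⋆ = oc-app sing∃∈ (λ _ → star) (A⋆ ∷ Eq⋆ ∷ []) (there (here refl))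

Eqf⋆f⋆ : Chase (eqP ⟨ f star ∷ f star ∷ [] ⟩)
Eqf⋆f⋆ = oc-app eq-refl∈ (λ _ → f star) (⊤f⋆ ∷ []) (here refl)

-- sing≤1 with x₀,…,x₄ ↦ ⋆ and x₅,x₆ ↦ f(⋆) compares R(⋆,⋆) with R(⋆,f(⋆))
Eq⋆f⋆ : Chase (eqP ⟨ star ∷ f star ∷ [] ⟩)
Eq⋆f⋆ = oc-app sing≤1∈ match
  (A⋆ ∷ R⋆ ∷ ⊤⋆ ∷ R⋆f⋆ ∷ ⊤f⋆ ∷ Eq⋆ ∷ Eq⋆ ∷ Eq⋆ ∷ Eq⋆ ∷ Eq⋆ ∷ Eqf⋆f⋆ ∷ Eqf⋆f⋆ ∷ [])
  (here refl)
  where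
  match : Subst
  match 5 = f star
  match 6 = f star
  match _ = star

-- sing⊓ with x₀ ↦ f(⋆) and x₁ ↦ ⋆ transfers A to f(⋆)
Af⋆ : Chase (con conceptA ⟨ f star ∷ [] ⟩)
Af⋆ = oc-app sing⊓∈ match (⊤f⋆ ∷ D⋆ ∷ Eqf⋆f⋆ ∷ Eq⋆f⋆ ∷ []) (here refl)
  where
  match : Subst
  match 0 = f star
  match _ = star

Rf⋆ff⋆ : Chase (rol roleR ⟨ f star ∷ f (f star) ∷ [] ⟩)
Rf⋆ff⋆ = oc-app sing∃∈ (λ _ → f star) (Af⋆ ∷ Eqf⋆f⋆ ∷ []) (here refl)

ff⋆-cyclic : Cyclic 1 (f (f star))
ff⋆-cyclic = sing∃ , 2 , args-of , ⊑-refl , λ { fzero → ⊑-arg ⊑-refl (here refl) , λ () }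
  where
  args-of : Fin 2 → List Term
  args-of fzero    = star ∷ []
  args-of (fsuc _) = f star ∷ []

T₀-not-MFA∪ : ¬ MFA∪ T₀
T₀-not-MFA∪ mfa = mfa (_ , f (f star) , Rf⋆ff⋆ , there (here refl) , ff⋆-cyclic)

theorem4 : (O : TermOrder) →
    Σ TBox λ T → HornSRIQ T × RCA O T 1 × ¬ MFA∪ T
theorem4 O = T₀ , T₀-Horn , T₀-RCA₁ O , T₀-not-MFA∪
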